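{- Let $F=\mathbb{F}_q$ be a finite field of odd order and let $K/F$ be a field extension of degree $3$. Then there exists a two-dimensional $F$-linear subspace $V\subset K$ such that whenever $y\in V$ and $y^2\in V$, we have $y=0$. Consequently $|V|=q^2=|K|^{2/3}$, and there are no $x,y\in K$ with $y\neq 0$ and $x,\ x+y,\ x+y^2\in V$. -}

module Defs where

open import Level using (Level; _⊔_)
open import Algebra.Bundles using (CommutativeRing)
open import Algebra.Morphism.Structures using (IsRingHomomorphism)
open import Data.Nat using (ℕ; zero; suc)
import Data.Nat as ℕ
open import Data.Fin using (Fin; zero; suc)
open import Data.Product using (Σ; _×_; ∃)
open import Function using (_∘_)
open import Data.Unit using (⊤)
open import Relation.Nullary using (¬_)
open import Relation.Binary.PropositionalEquality using (_≡_)

record IsField {c ℓ} (R : CommutativeRing c ℓ) : Set (c ⊔ ℓ) where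
  open CommutativeRing R
  field
    1≉0     : ¬ (1# ≈ 0#)
    inverse : ∀ x → ¬ (x ≈ 0#) → Σ Carrier (λ y → x * y ≈ 1#)

record SubsetHasSize {c ℓ p} (R : CommutativeRing c ℓ)
         (P : CommutativeRing.Carrier R → Set p) (n : ℕ) : Set (c ⊔ ℓ ⊔ p) where
  open CommutativeRing R
  field
    enum      : Fin n → Carrier
    enum-in   : ∀ i → P (enum i)
    enum-inj  : ∀ i j → enum i ≈ enum j → i ≡ j
    enum-surj : ∀ x → P x → Σ (Fin n) (λ i → enum i ≈ x)

HasSize : ∀ {c ℓ} (R : CommutativeRing c ℓ) (n : ℕ) → Set (c ⊔ ℓ)
HasSize R n = SubsetHasSize R (λ _ → ⊤) n

Odd : ℕ → Set
Odd q = Σ ℕ (λ k → q ≡ suc (2 ℕ.* k))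

module LinearAlgebra {c ℓ c' ℓ'} (F : CommutativeRing c ℓ) (K : CommutativeRing c' ℓ')
                     (ι : CommutativeRing.Carrier F → CommutativeRing.Carrier K) where
  private
    module F = CommutativeRing F
    module K = CommutativeRing K

  lincomb : ∀ n → (Fin n → F.Carrier) → (Fin n → K.Carrier) → K.Carrier
  lincomb zero    a e = K.0#
  lincomb (suc n) a e = ι (a zero) K.* e zero K.+ lincomb n (a ∘ suc) (e ∘ suc)

  InSpan : ∀ {n} → (Fin n → K.Carrier) → K.Carrier → Set (c ⊔ ℓ')
  InSpan {n} e z = Σ (Fin n → F.Carrier) (λ a → z K.≈ lincomb n a e)

  LinIndep : ∀ {n} → (Fin n → K.Carrier) → Set (c ⊔ ℓ ⊔ ℓ')
  LinIndep {n} e = ∀ a → lincomb n a e K.≈ K.0# → ∀ i → a i F.≈ F.0#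

  IsBasis : ∀ {n} → (Fin n → K.Carrier) → Set (c ⊔ c' ⊔ ℓ ⊔ ℓ')
  IsBasis e = LinIndep e × (∀ z → InSpan e z)

  HasDegree : ℕ → Set (c ⊔ c' ⊔ ℓ ⊔ ℓ')
  HasDegree n = Σ (Fin n → K.Carrier) IsBasis

module Submission where

-- Counting over F (|F| = q, so |K| = q³) gives two facts: any four elements of K are F-linearly
-- dependent, and fewer than three elements never span K. Hence if w ∉ F then 1, w, w² are
-- independent: a relation w² = p + r w would put every z in F + F w, since from
-- a₀ + a₁ w + (a₂ + a₃ w) z = 0, multiplying by the conjugate a₂ + a₃ (r − w) leaves the norm
-- N(a₂, a₃) ∈ F in front of z, and N(a₂, a₃) = 0 forces a₂ = a₃ = 0.
-- So w is a root of some X³ − A X² − B X − C with C ≠ 0. As q is odd, F has a non-square n;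
-- with k = C n, θ = 1 − k w is a root of some X³ − a X² − b X − c with 1 − a − b − c = k³ C,
-- a non-square. Take V = F θ + F (c + θ²), the kernel of x₀ + x₁ θ + x₂ θ² ↦ x₀ − c x₂.
-- If y = s θ + t (c + θ²) and y² = s′ θ + t′ (c + θ²), the coordinates E₀, E₂ of y² − (s′ θ + t′ (c + θ²))
-- at 1 and θ² vanish, and c E₂ − E₀ = c ((s + (a − 1) t)² − (1 − a − b − c) t²) vanishes only for
-- s = t = 0. Finally x, x + y, x + y² ∈ V give y, y² ∈ V.

open import Defs
open import Algebra.Bundles using (CommutativeRing)
open import Algebra.Morphism.Structures using (IsRingHomomorphism)
open import Data.Nat using (ℕ)
import Data.Nat as ℕ
open import Data.Fin using (Fin)
open import Data.Product using (Σ; _×_)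
open import Relation.Nullary using (¬_)

open import Level using (_⊔_)
open import Algebra.Bundles using (RawRing)
open import Data.Nat using (zero; suc)
import Data.Nat.Properties as ℕ
open import Data.Fin using (zero; suc; #_; punchIn; punchOut; funToFin; finToFun; combine)
import Data.Fin.Properties as Fin
open import Data.Integer using (+_)
open import Data.Product using (∃; _,_; proj₁; proj₂)
open import Data.Sum using (_⊎_; inj₁; inj₂; [_,_]′; reduce)
open import Data.Unit using (tt)
open import Data.Vec using (Vec; []; _∷_; lookup)
import Data.Vec as Vec
import Data.Vec.Properties as Vec
open import Function using (_∘_)
open import Relation.Binary.Definitions using (Decidable)
open import Relation.Binary.PropositionalEquality as ≡ using (_≡_; _≢_)
open import Relation.Nullary using (Dec; yes; no; contradiction; ¬?)
open import Relation.Nullary.Decidable using (decidable-stable)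
open import Tactic.RingSolver.Core.Expression using (Expr; Κ; Ι; _⊕_; _⊗_; _⊛_; ⊝_; module Eval)

module IntegerCoefficientSolver {c ℓ} (R : CommutativeRing c ℓ) where
  open import Data.Integer as ℤ using (ℤ; -[1+_]; _⊖_)
  import Data.Integer.Properties as ℤ
  open import Data.Sign as Sign using (Sign)
  open import Data.Maybe using (Maybe; just; nothing)
  import Algebra.Solver.Ring.AlmostCommutativeRing as ACR

  open CommutativeRing R
  open import Relation.Binary.Reasoning.Setoid setoid
  -- the optimised multiple, so that the solver's constants con (+ 0) and con (+ 1) reduce to 0# and 1#
  open import Algebra.Properties.Semiring.Mult.TCOptimised semiring
    using (1+×; ×-homo-+; ×1-homo-*) renaming (_×_ to _×′_)
  open import Algebra.Properties.Ring ring using (-1*x≈-x)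
  open import Algebra.Properties.AbelianGroup +-abelianGroup using (⁻¹-∙-comm; ⁻¹-involutive; ε⁻¹≈ε)
  open import Algebra.Properties.CommutativeSemigroup +-commutativeSemigroup
    using () renaming (interchange to +-interchange)
  open import Algebra.Properties.CommutativeSemigroup *-commutativeSemigroup
    using () renaming (interchange to *-interchange)

  fromℕ : ℕ → Carrier
  fromℕ n = n ×′ 1#

  private
    ⟦_⟧ℤ : ℤ → Carrier
    ⟦ + n      ⟧ℤ = fromℕ n
    ⟦ -[1+ n ] ⟧ℤ = - fromℕ (suc n)

    ⊖-homo : ∀ m n → ⟦ m ⊖ n ⟧ℤ ≈ fromℕ m - fromℕ n
    ⊖-homo m       zero    = sym (trans (+-congˡ ε⁻¹≈ε) (+-identityʳ _))
    ⊖-homo zero    (suc n) = sym (+-identityˡ _)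
    ⊖-homo (suc m) (suc n) = begin
      ⟦ suc m ⊖ suc n ⟧ℤ                      ≡⟨ ≡.cong ⟦_⟧ℤ (ℤ.[1+m]⊖[1+n]≡m⊖n m n) ⟩
      ⟦ m ⊖ n ⟧ℤ                              ≈⟨ ⊖-homo m n ⟩
      fromℕ m - fromℕ n                       ≈⟨ +-identityˡ _ ⟨
      0# + (fromℕ m - fromℕ n)                ≈⟨ +-congʳ (-‿inverseʳ 1#) ⟨
      (1# - 1#) + (fromℕ m - fromℕ n)         ≈⟨ +-interchange 1# (- 1#) _ _ ⟩
      (1# + fromℕ m) + (- 1# - fromℕ n)       ≈⟨ +-cong (1+× m 1#) (trans (-‿cong (1+× n 1#)) (sym (⁻¹-∙-comm 1# _))) ⟨
      fromℕ (suc m) - fromℕ (suc n)           ∎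

    +-homo : ∀ i j → ⟦ i ℤ.+ j ⟧ℤ ≈ ⟦ i ⟧ℤ + ⟦ j ⟧ℤ
    +-homo (+ m)    (+ n)    = ×-homo-+ 1# m n
    +-homo (+ m)    -[1+ n ] = ⊖-homo m (suc n)
    +-homo -[1+ m ] (+ n)    = trans (⊖-homo n (suc m)) (+-comm _ _)
    +-homo -[1+ m ] -[1+ n ] = begin
      - fromℕ (suc (suc (m ℕ.+ n)))           ≡⟨ ≡.cong (λ k → - fromℕ (suc k)) (ℕ.+-suc m n) ⟨
      - fromℕ (suc m ℕ.+ suc n)               ≈⟨ -‿cong (×-homo-+ 1# (suc m) (suc n)) ⟩
      - (fromℕ (suc m) + fromℕ (suc n))       ≈⟨ ⁻¹-∙-comm _ _ ⟨
      - fromℕ (suc m) + - fromℕ (suc n)       ∎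

    signed : Sign → Carrier
    signed Sign.+ = 1#
    signed Sign.- = - 1#

    signed-homo : ∀ s t → signed (s Sign.* t) ≈ signed s * signed t
    signed-homo Sign.+ t      = sym (*-identityˡ _)
    signed-homo Sign.- Sign.+ = sym (*-identityʳ _)
    signed-homo Sign.- Sign.- = sym (trans (-1*x≈-x _) (⁻¹-involutive _))

    ◃-homo : ∀ s n → ⟦ s ℤ.◃ n ⟧ℤ ≈ signed s * fromℕ n
    ◃-homo s      zero    = sym (zeroʳ _)
    ◃-homo Sign.+ (suc n) = sym (*-identityˡ _)
    ◃-homo Sign.- (suc n) = sym (-1*x≈-x _)

    *-homo : ∀ i j → ⟦ i ℤ.* j ⟧ℤ ≈ ⟦ i ⟧ℤ * ⟦ j ⟧ℤ
    *-homo i j = begin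
      ⟦ i ℤ.* j ⟧ℤ                                ≈⟨ ◃-homo (s Sign.* t) (m ℕ.* n) ⟩
      signed (s Sign.* t) * fromℕ (m ℕ.* n)       ≈⟨ *-cong (signed-homo s t) (×1-homo-* m n) ⟩
      (signed s * signed t) * (fromℕ m * fromℕ n) ≈⟨ *-interchange _ _ _ _ ⟩
      (signed s * fromℕ m) * (signed t * fromℕ n) ≈⟨ *-cong (◃-homo s m) (◃-homo t n) ⟨
      ⟦ s ℤ.◃ m ⟧ℤ * ⟦ t ℤ.◃ n ⟧ℤ                 ≡⟨ ≡.cong₂ _*ℤ_ (ℤ.◃-inverse i) (ℤ.◃-inverse j) ⟩
      ⟦ i ⟧ℤ * ⟦ j ⟧ℤ                             ∎
      where
      s = ℤ.sign i
      t = ℤ.sign j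
      m = ℤ.∣ i ∣
      n = ℤ.∣ j ∣
      _*ℤ_ = λ x y → ⟦ x ⟧ℤ * ⟦ y ⟧ℤ

    -‿homo : ∀ i → ⟦ ℤ.- i ⟧ℤ ≈ - ⟦ i ⟧ℤ
    -‿homo (+ zero)  = sym ε⁻¹≈ε
    -‿homo (+ suc n) = refl
    -‿homo -[1+ n ]  = sym (⁻¹-involutive _)

    ℤ⟶R : ℤ.+-*-rawRing ACR.-Raw-AlmostCommutative⟶ ACR.fromCommutativeRing R
    ℤ⟶R = record
      { ⟦_⟧ = ⟦_⟧ℤ ; +-homo = +-homo ; *-homo = *-homo ; -‿homo = -‿homo
      ; 0-homo = refl ; 1-homo = refl }

    ⟦_⟧ℤ-≟ : ∀ i j → Maybe (⟦ i ⟧ℤ ≈ ⟦ j ⟧ℤ)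
    ⟦ i ⟧ℤ-≟ j with i ℤ.≟ j
    ... | yes ≡.refl = just refl
    ... | no  _      = nothing

  open import Algebra.Solver.Ring ℤ.+-*-rawRing (ACR.fromCommutativeRing R) ℤ⟶R ⟦_⟧ℤ-≟ public

fixedPointFree-involution⇒even : ∀ n (g : Fin n → Fin n) → (∀ i → g (g i) ≡ i) → (∀ i → g i ≢ i) →
                                  ∃ λ k → n ≡ 2 ℕ.* k
fixedPointFree-involution⇒even zero g invol free = 0 , ≡.refl
fixedPointFree-involution⇒even (suc zero) g invol free with g zero in g0≡0
... | zero = contradiction g0≡0 (free zero)
fixedPointFree-involution⇒even (suc (suc m)) g invol free with g zero in g0≡1+j
... | zero  = contradiction g0≡1+j (free zero)
... | suc j =
  let k , m≡2k = fixedPointFree-involution⇒even m h h-invol h-free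
  in suc k , ≡.trans (≡.cong (2 ℕ.+_) m≡2k) (≡.sym (ℕ.*-suc 2 k))
  where
  -- e enumerates the complement of the 2-cycle {0, 1 + j}, and h is g restricted to it
  e : Fin m → Fin (suc (suc m))
  e i = suc (punchIn j i)

  e-injective : ∀ {i i′} → e i ≡ e i′ → i ≡ i′
  e-injective = Fin.punchIn-injective j _ _ ∘ Fin.suc-injective

  g∘e≢0 : ∀ i → zero ≢ g (e i)
  g∘e≢0 i p = Fin.punchInᵢ≢i j i
    (Fin.suc-injective (≡.trans (≡.sym (invol (e i))) (≡.trans (≡.cong g (≡.sym p)) g0≡1+j)))

  g∘e≢1+j : ∀ i → suc j ≢ g (e i)
  g∘e≢1+j i p = Fin.0≢1+n (≡.trans (≡.sym (invol zero)) (≡.trans (≡.cong g (≡.trans g0≡1+j p)) (invol (e i))))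

  j≢pred-g∘e : ∀ i → j ≢ punchOut (g∘e≢0 i)
  j≢pred-g∘e i p = g∘e≢1+j i (≡.trans (≡.cong suc p) (Fin.punchIn-punchOut (g∘e≢0 i)))

  h : Fin m → Fin m
  h i = punchOut (j≢pred-g∘e i)

  e∘h : ∀ i → e (h i) ≡ g (e i)
  e∘h i = ≡.trans (≡.cong suc (Fin.punchIn-punchOut (j≢pred-g∘e i))) (Fin.punchIn-punchOut (g∘e≢0 i))

  h-invol : ∀ i → h (h i) ≡ i
  h-invol i = e-injective (≡.trans (e∘h (h i)) (≡.trans (≡.cong g (e∘h i)) (invol (e i))))

  h-free : ∀ i → h i ≢ i
  h-free i p = free (e i) (≡.trans (≡.sym (e∘h i)) (≡.cong e p))

surjective⇒injective : ∀ {n} (f : Fin n → Fin n) → (∀ j → ∃ λ i → f i ≡ j) →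
                       ∀ {i₀ i₁} → f i₀ ≡ f i₁ → i₀ ≡ i₁
surjective⇒injective {suc m} f surj {i₀} {i₁} fi₀≡fi₁ with i₀ Fin.≟ i₁
... | yes i₀≡i₁ = i₀≡i₁
... | no  i₀≢i₁ = contradiction (Fin.injective⇒≤ h-injective) ℕ.1+n≰n
  where
  section-avoiding-i₁ : ∀ j → ∃ λ i → f i ≡ j × i₁ ≢ i
  section-avoiding-i₁ j with i , fi≡j ← surj j with i₁ Fin.≟ i
  ... | yes i₁≡i = i₀ , ≡.trans fi₀≡fi₁ (≡.trans (≡.cong f i₁≡i) fi≡j) , i₀≢i₁ ∘ ≡.sym
  ... | no  i₁≢i = i , fi≡j , i₁≢i

  avoids-i₁ : ∀ j → i₁ ≢ proj₁ (section-avoiding-i₁ j)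
  avoids-i₁ j = proj₂ (proj₂ (section-avoiding-i₁ j))

  h : Fin (suc m) → Fin m
  h j = punchOut (avoids-i₁ j)

  h-injective : ∀ {j j′} → h j ≡ h j′ → j ≡ j′
  h-injective {j} {j′} p = ≡.trans (≡.sym (proj₁ (proj₂ (section-avoiding-i₁ j))))
    (≡.trans (≡.cong f (Fin.punchOut-injective (avoids-i₁ j) (avoids-i₁ j′) p))
             (proj₁ (proj₂ (section-avoiding-i₁ j′))))

funToFin-cong : ∀ {m n} {f g : Fin m → Fin n} → (∀ k → f k ≡ g k) → funToFin f ≡ funToFin g
funToFin-cong {zero}  eq = ≡.refl
funToFin-cong {suc m} eq = ≡.cong₂ combine (eq zero) (funToFin-cong (eq ∘ suc))

module FieldProperties {c ℓ} (R : CommutativeRing c ℓ) (isField : IsField R) where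
  open CommutativeRing R
  open IsField isField
  open import Relation.Binary.Reasoning.Setoid setoid
  open IntegerCoefficientSolver R

  inv : ∀ x → ¬ x ≈ 0# → Carrier
  inv x x≉0 = proj₁ (inverse x x≉0)

  *-inverseʳ : ∀ x (x≉0 : ¬ x ≈ 0#) → x * inv x x≉0 ≈ 1#
  *-inverseʳ x x≉0 = proj₂ (inverse x x≉0)

  *-cancelˡ-≈0 : ∀ {x y} → ¬ x ≈ 0# → x * y ≈ 0# → y ≈ 0#
  *-cancelˡ-≈0 {x} {y} x≉0 xy≈0 = begin
    y               ≈⟨ solve 1 (λ y → y := y :* con (+ 1)) refl y ⟩
    y * 1#          ≈⟨ *-congˡ (*-inverseʳ x x≉0) ⟨
    y * (x * x⁻¹)   ≈⟨ solve 3 (λ x y x⁻¹ → y :* (x :* x⁻¹) := (x :* y) :* x⁻¹) refl x y x⁻¹ ⟩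
    (x * y) * x⁻¹   ≈⟨ *-congʳ xy≈0 ⟩
    0# * x⁻¹        ≈⟨ zeroˡ x⁻¹ ⟩
    0#              ∎
    where x⁻¹ = inv x x≉0

  *-nonzero : ∀ {x y} → ¬ x ≈ 0# → ¬ y ≈ 0# → ¬ x * y ≈ 0#
  *-nonzero x≉0 y≉0 xy≈0 = y≉0 (*-cancelˡ-≈0 x≉0 xy≈0)

  NonSquare : Carrier → Set (c ⊔ ℓ)
  NonSquare d = ∀ x → ¬ x * x ≈ d

  nonSquare-resp : ∀ {d d′} → d ≈ d′ → NonSquare d → NonSquare d′
  nonSquare-resp d≈d′ nonSquare x x²≈d′ = nonSquare x (trans x²≈d′ (sym d≈d′))

  nonSquare⇒≉0 : ∀ {d} → NonSquare d → ¬ d ≈ 0#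
  nonSquare⇒≉0 nonSquare d≈0 = nonSquare 0# (trans (zeroˡ 0#) (sym d≈0))

  nonSquare-*-square : ∀ {d x} → NonSquare d → ¬ x ≈ 0# → NonSquare (x * x * d)
  nonSquare-*-square {d} {x} nonSquare x≉0 y y²≈x²d = nonSquare (y * x⁻¹) (begin
    (y * x⁻¹) * (y * x⁻¹)        ≈⟨ solve 2 (λ y x⁻¹ → (y :* x⁻¹) :* (y :* x⁻¹) := (y :* y) :* (x⁻¹ :* x⁻¹))
                                           refl y x⁻¹ ⟩
    (y * y) * (x⁻¹ * x⁻¹)        ≈⟨ *-congʳ y²≈x²d ⟩
    (x * x * d) * (x⁻¹ * x⁻¹)    ≈⟨ solve 3 (λ x d x⁻¹ → (x :* x :* d) :* (x⁻¹ :* x⁻¹)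
                                                       := d :* ((x :* x⁻¹) :* (x :* x⁻¹))) refl x d x⁻¹ ⟩
    d * ((x * x⁻¹) * (x * x⁻¹))  ≈⟨ *-congˡ (*-cong (*-inverseʳ x x≉0) (*-inverseʳ x x≉0)) ⟩
    d * (1# * 1#)                ≈⟨ solve 1 (λ d → d :* (con (+ 1) :* con (+ 1)) := d) refl d ⟩
    d                            ∎)
    where x⁻¹ = inv x x≉0

  module _ (_≟_ : Decidable _≈_) where

    x*y≈0⇒x≈0∨y≈0 : ∀ {x y} → x * y ≈ 0# → x ≈ 0# ⊎ y ≈ 0#
    x*y≈0⇒x≈0∨y≈0 {x} xy≈0 with x ≟ 0#
    ... | yes x≈0 = inj₁ x≈0
    ... | no  x≉0 = inj₂ (*-cancelˡ-≈0 x≉0 xy≈0)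

    nonSquare⇒anisotropic : ∀ {d u t} → NonSquare d → u * u ≈ d * (t * t) → u ≈ 0# × t ≈ 0#
    nonSquare⇒anisotropic {d} {u} {t} nonSquare u²≈dt² with t ≟ 0#
    ... | no  t≉0 = contradiction (trans u²≈dt² (*-comm d _)) (nonSquare-*-square nonSquare t≉0 u)
    ... | yes t≈0 = reduce (x*y≈0⇒x≈0∨y≈0 (begin
      u * u          ≈⟨ u²≈dt² ⟩
      d * (t * t)    ≈⟨ *-congˡ (*-congʳ t≈0) ⟩
      d * (0# * t)   ≈⟨ solve 2 (λ d t → d :* (con (+ 0) :* t) := con (+ 0)) refl d t ⟩
      0#             ∎)) , t≈0

module Finite {c ℓ} (R : CommutativeRing c ℓ) {n} (size : HasSize R n) where
  open CommutativeRing R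
  open SubsetHasSize size public using (enum; enum-inj)

  index : Carrier → Fin n
  index x = proj₁ (SubsetHasSize.enum-surj size x tt)

  enum-index : ∀ x → enum (index x) ≈ x
  enum-index x = proj₂ (SubsetHasSize.enum-surj size x tt)

  index-enum : ∀ i → index (enum i) ≡ i
  index-enum i = enum-inj _ _ (enum-index (enum i))

  index-cong : ∀ {x y} → x ≈ y → index x ≡ index y
  index-cong {x} {y} x≈y = enum-inj _ _ (trans (enum-index x) (trans x≈y (sym (enum-index y))))

  index-injective : ∀ {x y} → index x ≡ index y → x ≈ y
  index-injective {x} {y} eq = trans (sym (enum-index x)) (trans (reflexive (≡.cong enum eq)) (enum-index y))

  _≟_ : Decidable _≈_
  x ≟ y with index x Fin.≟ index y
  ... | yes eq  = yes (index-injective eq)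
  ... | no  neq = no (neq ∘ index-cong)

  encode : ∀ {m} → (Fin m → Carrier) → Fin (n ℕ.^ m)
  encode a = funToFin (index ∘ a)

  decode : ∀ {m} → Fin (n ℕ.^ m) → Fin m → Carrier
  decode i = enum ∘ finToFun i

  decode-encode : ∀ {m} (a : Fin m → Carrier) k → decode (encode a) k ≈ a k
  decode-encode a k = trans (reflexive (≡.cong enum (Fin.finToFun-funToFin (index ∘ a) k))) (enum-index (a k))

  encode-injective : ∀ {m} {a b : Fin m → Carrier} → encode a ≡ encode b → ∀ k → a k ≈ b k
  encode-injective {a = a} {b} eq k =
    trans (sym (decode-encode a k)) (trans (reflexive (≡.cong (λ i → decode i k) eq)) (decode-encode b k))

  decode-injective : ∀ {m} {i j : Fin (n ℕ.^ m)} → (∀ (k : Fin m) → decode i k ≈ decode j k) → i ≡ j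
  decode-injective {m} {i} {j} eq = begin
    i                                ≡⟨ Fin.funToFin-finToFin {m} i ⟨
    funToFin (finToFun {n} {m} i)    ≡⟨ funToFin-cong (λ k → enum-inj _ _ (eq k)) ⟩
    funToFin (finToFun {n} {m} j)    ≡⟨ Fin.funToFin-finToFin {m} j ⟩
    j                                ∎
    where open ≡.≡-Reasoning

module FiniteField {c ℓ} (F : CommutativeRing c ℓ) (isField : IsField F) {q} (size : HasSize F q) where
  open CommutativeRing F
  open IsField isField using (1≉0)
  open import Relation.Binary.Reasoning.Setoid setoid
  open Finite F size
  open FieldProperties F isField
  open IntegerCoefficientSolver F

  1<q : 1 ℕ.< q
  1<q = distinct⇒1< (index 1#) (index 0#) (1≉0 ∘ index-injective)
    where
    distinct⇒1< : ∀ {n} (i j : Fin n) → i ≢ j → 1 ℕ.< n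
    distinct⇒1< {suc zero}    zero zero i≢j = contradiction ≡.refl i≢j
    distinct⇒1< {suc (suc n)} _    _    _   = ℕ.s≤s (ℕ.s≤s ℕ.z≤n)

  1+1≉0 : Odd q → ¬ 1# + 1# ≈ 0#
  1+1≉0 (k , q≡1+2k) 1+1≈0 =
    let l , q≡2l = fixedPointFree-involution⇒even q +1 +1-involutive +1-fixedPointFree
    in ℕ.even≢odd l k (≡.trans (≡.sym q≡2l) q≡1+2k)
    where
    +1 : Fin q → Fin q
    +1 i = index (enum i + 1#)

    +1-involutive : ∀ i → +1 (+1 i) ≡ i
    +1-involutive i = ≡.trans (index-cong (begin
      enum (+1 i) + 1#     ≈⟨ +-congʳ (enum-index _) ⟩
      (enum i + 1#) + 1#   ≈⟨ +-assoc _ _ _ ⟩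
      enum i + (1# + 1#)   ≈⟨ +-congˡ 1+1≈0 ⟩
      enum i + 0#          ≈⟨ +-identityʳ _ ⟩
      enum i               ∎)) (index-enum i)

    +1-fixedPointFree : ∀ i → +1 i ≢ i
    +1-fixedPointFree i +1i≡i = 1≉0 (begin
      1#                       ≈⟨ solve 2 (λ x y → y := (x :+ y) :- x) refl (enum i) 1# ⟩
      (enum i + 1#) - enum i   ≈⟨ +-congʳ (enum-index _) ⟨
      enum (+1 i) - enum i     ≡⟨ ≡.cong (λ j → enum j - enum i) +1i≡i ⟩
      enum i - enum i          ≈⟨ -‿inverseʳ _ ⟩
      0#                       ∎)

  ∃nonSquare : Odd q → ∃ NonSquare
  ∃nonSquare odd = enum j , λ x x²≈j →
    missed (index x , ≡.trans (index-cong (trans (*-cong (enum-index x) (enum-index x)) x²≈j)) (index-enum j))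
    where
    square : Fin q → Fin q
    square i = index (enum i * enum i)

    1≉-1 : ¬ 1# ≈ - 1#
    1≉-1 1≈-1 = 1+1≉0 odd (trans (+-congˡ 1≈-1) (-‿inverseʳ 1#))

    square-1≡square-[-1] : square (index 1#) ≡ square (index (- 1#))
    square-1≡square-[-1] = index-cong (begin
      enum (index 1#) * enum (index 1#)          ≈⟨ *-cong (enum-index _) (enum-index _) ⟩
      1# * 1#                                    ≈⟨ solve 0 (con (+ 1) :* con (+ 1) := (:- con (+ 1)) :* (:- con (+ 1))) refl ⟩
      - 1# * - 1#                                ≈⟨ *-cong (enum-index _) (enum-index _) ⟨
      enum (index (- 1#)) * enum (index (- 1#))  ∎)

    square-nonsurjective : ¬ (∀ j → ∃ λ i → square i ≡ j)
    square-nonsurjective surj = 1≉-1 (index-injective (surjective⇒injective square surj square-1≡square-[-1]))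

    nonsquare-index : ∃ λ j → ¬ ∃ λ i → square i ≡ j
    nonsquare-index = Fin.¬∀⟶∃¬ q _ (λ j → Fin.any? (λ i → square i Fin.≟ j)) square-nonsurjective

    j = proj₁ nonsquare-index
    missed = proj₂ nonsquare-index

-- If w³ = A w² + B w + C, then θ = 1 − k w satisfies θ³ = a θ² + b θ + c with these a, b, c,
-- polynomials in k, A, B, C. They are expressions so that they can be evaluated in F and in K.
rescaled-a rescaled-b rescaled-c : Expr ℕ 4
rescaled-a = Κ 3 ⊕ ⊝ (k ⊗ A)
  where k = Ι (# 0) ; A = Ι (# 1)
rescaled-b = k ⊗ A ⊕ k ⊗ A ⊕ k ⊗ k ⊗ B ⊕ ⊝ Κ 3
  where k = Ι (# 0) ; A = Ι (# 1) ; B = Ι (# 2)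
rescaled-c = Κ 1 ⊕ ⊝ (k ⊗ A) ⊕ ⊝ (k ⊗ k ⊗ B) ⊕ ⊝ (k ⊗ k ⊗ k ⊗ C)
  where k = Ι (# 0) ; A = Ι (# 1) ; B = Ι (# 2) ; C = Ι (# 3)

-- The coordinates at 1, θ, θ² of (s θ + t (c + θ²))² − (s′ θ + t′ (c + θ²)) when θ³ = a θ² + b θ + c,
-- polynomials in s, t, s′, t′, a, b, c.
square-coordinate₀ square-coordinate₁ square-coordinate₂ : Expr ℕ 7
square-coordinate₀ = C ⊗ C ⊗ T ⊗ T ⊕ Κ 2 ⊗ S ⊗ T ⊗ C ⊕ T ⊗ T ⊗ A ⊗ C ⊕ ⊝ (C ⊗ T′)
  where S = Ι (# 0) ; T = Ι (# 1) ; T′ = Ι (# 3) ; A = Ι (# 4) ; C = Ι (# 6)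
square-coordinate₁ = Κ 2 ⊗ C ⊗ S ⊗ T ⊕ Κ 2 ⊗ S ⊗ T ⊗ B ⊕ T ⊗ T ⊗ (A ⊗ B ⊕ C) ⊕ ⊝ S′
  where S = Ι (# 0) ; T = Ι (# 1) ; S′ = Ι (# 2) ; A = Ι (# 4) ; B = Ι (# 5) ; C = Ι (# 6)
square-coordinate₂ = S ⊗ S ⊕ Κ 2 ⊗ C ⊗ T ⊗ T ⊕ Κ 2 ⊗ S ⊗ T ⊗ A ⊕ T ⊗ T ⊗ (A ⊗ A ⊕ B) ⊕ ⊝ T′
  where S = Ι (# 0) ; T = Ι (# 1) ; T′ = Ι (# 3) ; A = Ι (# 4) ; B = Ι (# 5) ; C = Ι (# 6)

module CubicArithmetic {c ℓ} (R : CommutativeRing c ℓ) (isField : IsField R) where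
  open CommutativeRing R
  open FieldProperties R isField
  open import Relation.Binary.Reasoning.Setoid setoid
  open import Algebra.Properties.AbelianGroup +-abelianGroup using () renaming (x∙y⁻¹≈ε⇒x≈y to x-y≈0⇒x≈y)
  open IntegerCoefficientSolver R hiding (⟦_⟧)
  open Eval rawRing fromℕ

  rescaled-cubic : ∀ k A B C w →
    (1# - k * w) * ((1# - k * w) * (1# - k * w))
      - (⟦ rescaled-a ⟧ (k ∷ A ∷ B ∷ C ∷ []) * ((1# - k * w) * (1# - k * w))
         + ⟦ rescaled-b ⟧ (k ∷ A ∷ B ∷ C ∷ []) * (1# - k * w) + ⟦ rescaled-c ⟧ (k ∷ A ∷ B ∷ C ∷ []))
    ≈ - (k * k * k) * (w * (w * w) - (A * (w * w) + B * w + C))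
  rescaled-cubic = solve 5 (λ k A B C w →
    (con (+ 1) :- k :* w) :* ((con (+ 1) :- k :* w) :* (con (+ 1) :- k :* w))
      :- ((con (+ 3) :+ :- (k :* A)) :* ((con (+ 1) :- k :* w) :* (con (+ 1) :- k :* w))
          :+ (k :* A :+ k :* A :+ k :* k :* B :+ :- con (+ 3)) :* (con (+ 1) :- k :* w)
          :+ (con (+ 1) :+ :- (k :* A) :+ :- (k :* k :* B) :+ :- (k :* k :* k :* C)))
    := :- (k :* k :* k) :* (w :* (w :* w) :- (A :* (w :* w) :+ B :* w :+ C))) refl

  rescaled-discriminant : ∀ k A B C →
    1# - ⟦ rescaled-a ⟧ (k ∷ A ∷ B ∷ C ∷ []) - ⟦ rescaled-b ⟧ (k ∷ A ∷ B ∷ C ∷ [])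
       - ⟦ rescaled-c ⟧ (k ∷ A ∷ B ∷ C ∷ [])
    ≈ k * k * k * C
  rescaled-discriminant = solve 4 (λ k A B C →
    con (+ 1) :- (con (+ 3) :+ :- (k :* A)) :- (k :* A :+ k :* A :+ k :* k :* B :+ :- con (+ 3))
      :- (con (+ 1) :+ :- (k :* A) :+ :- (k :* k :* B) :+ :- (k :* k :* k :* C))
    := k :* k :* k :* C) refl

  nonSquare-cube : ∀ {n C} → NonSquare n → ¬ C ≈ 0# → NonSquare ((C * n) * (C * n) * (C * n) * C)
  nonSquare-cube {n} {C} nonSquare C≉0 =
    nonSquare-resp (solve 2 (λ C n → (C :* C :* n) :* (C :* C :* n) :* n := (C :* n) :* (C :* n) :* (C :* n) :* C)
                            refl C n)
                   (nonSquare-*-square nonSquare (*-nonzero (*-nonzero C≉0 C≉0) (nonSquare⇒≉0 nonSquare)))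

  square-expansion : ∀ s t s′ t′ a b c θ →
    ⟦ square-coordinate₀ ⟧ (s ∷ t ∷ s′ ∷ t′ ∷ a ∷ b ∷ c ∷ [])
      + ⟦ square-coordinate₁ ⟧ (s ∷ t ∷ s′ ∷ t′ ∷ a ∷ b ∷ c ∷ []) * θ
      + ⟦ square-coordinate₂ ⟧ (s ∷ t ∷ s′ ∷ t′ ∷ a ∷ b ∷ c ∷ []) * (θ * θ)
    ≈ ((s * θ + t * (c + θ * θ)) * (s * θ + t * (c + θ * θ)) - (s′ * θ + t′ * (c + θ * θ)))
      - (t * t * θ + (fromℕ 2 * s * t + t * t * a)) * (θ * (θ * θ) - (a * (θ * θ) + b * θ + c))
  square-expansion = solve 8 (λ s t s′ t′ a b c θ →
      c :* c :* t :* t :+ con (+ 2) :* s :* t :* c :+ t :* t :* a :* c :+ :- (c :* t′)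
      :+ (con (+ 2) :* c :* s :* t :+ con (+ 2) :* s :* t :* b :+ t :* t :* (a :* b :+ c) :+ :- s′) :* θ
      :+ (s :* s :+ con (+ 2) :* c :* t :* t :+ con (+ 2) :* s :* t :* a :+ t :* t :* (a :* a :+ b) :+ :- t′) :* (θ :* θ)
    := ((s :* θ :+ t :* (c :+ θ :* θ)) :* (s :* θ :+ t :* (c :+ θ :* θ)) :- (s′ :* θ :+ t′ :* (c :+ θ :* θ)))
       :- (t :* t :* θ :+ (con (+ 2) :* s :* t :+ t :* t :* a)) :* (θ :* (θ :* θ) :- (a :* (θ :* θ) :+ b :* θ :+ c)))
    refl

  module _ (_≟_ : Decidable _≈_) where

    -- c E₂ − E₀ = c ((s + (a − 1) t)² − (1 − a − b − c) t²) for E₀ = square-coordinate₀ and E₂ = square-coordinate₂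
    square-coordinates≈0 : ∀ {a b c s t s′ t′} → ¬ c ≈ 0# → NonSquare (1# - a - b - c) →
      ⟦ square-coordinate₀ ⟧ (s ∷ t ∷ s′ ∷ t′ ∷ a ∷ b ∷ c ∷ []) ≈ 0# →
      ⟦ square-coordinate₂ ⟧ (s ∷ t ∷ s′ ∷ t′ ∷ a ∷ b ∷ c ∷ []) ≈ 0# →
      s ≈ 0# × t ≈ 0#
    square-coordinates≈0 {a} {b} {c} {s} {t} {s′} {t′} c≉0 nonSquare E₀≈0 E₂≈0 = s≈0 , t≈0
      where
      u = s + (a - 1#) * t

      u²≈dt² : u * u ≈ (1# - a - b - c) * (t * t)
      u²≈dt² = x-y≈0⇒x≈y _ _ (*-cancelˡ-≈0 c≉0 (begin
        c * (u * u - (1# - a - b - c) * (t * t))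
          ≈⟨ solve 6 (λ a b c s t t′ →
               c :* ((s :+ (a :- con (+ 1)) :* t) :* (s :+ (a :- con (+ 1)) :* t) :- (con (+ 1) :- a :- b :- c) :* (t :* t))
               := c :* (s :* s :+ con (+ 2) :* c :* t :* t :+ con (+ 2) :* s :* t :* a :+ t :* t :* (a :* a :+ b) :+ :- t′)
                  :- (c :* c :* t :* t :+ con (+ 2) :* s :* t :* c :+ t :* t :* a :* c :+ :- (c :* t′)))
             refl a b c s t t′ ⟩
        c * ⟦ square-coordinate₂ ⟧ (s ∷ t ∷ s′ ∷ t′ ∷ a ∷ b ∷ c ∷ [])
          - ⟦ square-coordinate₀ ⟧ (s ∷ t ∷ s′ ∷ t′ ∷ a ∷ b ∷ c ∷ [])
          ≈⟨ +-cong (*-congˡ E₂≈0) (-‿cong E₀≈0) ⟩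
        c * 0# - 0#
          ≈⟨ solve 1 (λ c → c :* con (+ 0) :- con (+ 0) := con (+ 0)) refl c ⟩
        0# ∎))

      u≈0×t≈0 = nonSquare⇒anisotropic _≟_ nonSquare u²≈dt²
      t≈0 = proj₂ u≈0×t≈0

      s≈0 : s ≈ 0#
      s≈0 = begin
        s                       ≈⟨ solve 3 (λ s t a → s := (s :+ (a :- con (+ 1)) :* t) :- (a :- con (+ 1)) :* t) refl s t a ⟩
        u - (a - 1#) * t        ≈⟨ +-cong (proj₁ u≈0×t≈0) (-‿cong (*-congˡ t≈0)) ⟩
        0# - (a - 1#) * 0#      ≈⟨ solve 1 (λ a → con (+ 0) :- (a :- con (+ 1)) :* con (+ 0) := con (+ 0)) refl a ⟩
        0#                      ∎

module FiniteExtension {cF ℓF cK ℓK} (F : CommutativeRing cF ℓF) (K : CommutativeRing cK ℓK)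
                       (isFieldF : IsField F) (isFieldK : IsField K) {q} (sizeF : HasSize F q)
                       (ι : CommutativeRing.Carrier F → CommutativeRing.Carrier K)
                       (hom : IsRingHomomorphism (CommutativeRing.rawRing F) (CommutativeRing.rawRing K) ι) where
  module F where
    open CommutativeRing F public hiding (zero)
    open FieldProperties F isFieldF public
    open Finite F sizeF public
    open FiniteField F isFieldF sizeF public
    open CubicArithmetic F isFieldF public
    open IntegerCoefficientSolver F public using (fromℕ)
    open Eval rawRing fromℕ public
    open import Algebra.Definitions.RawSemiring (RawRing.rawSemiring rawRing) public using (_^′_)
    open import Algebra.Properties.AbelianGroup +-abelianGroup public using () renaming (x∙y⁻¹≈ε⇒x≈y to x-y≈0⇒x≈y)

  open CommutativeRing K hiding (zero)
  open IsField isFieldK using (1≉0)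
  open IsRingHomomorphism hom
  open LinearAlgebra F K ι
  open import Relation.Binary.Reasoning.Setoid setoid
  open import Algebra.Properties.AbelianGroup +-abelianGroup using () renaming (x≈y⇒x∙y⁻¹≈ε to x≈y⇒x-y≈0)
  open IntegerCoefficientSolver K hiding (⟦_⟧)
  open Eval rawRing fromℕ
  open import Algebra.Definitions.RawSemiring (RawRing.rawSemiring rawRing) using (_^′_)

  ι≈0 : ∀ {a} → a F.≈ F.0# → ι a ≈ 0#
  ι≈0 a≈0 = trans (⟦⟧-cong a≈0) 0#-homo

  ι-injective : ∀ {x} → ι x ≈ 0# → x F.≈ F.0#
  ι-injective {x} ιx≈0 with x F.≟ F.0#
  ... | yes x≈0 = x≈0
  ... | no  x≉0 = contradiction (begin
    1#                       ≈⟨ 1#-homo ⟨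
    ι F.1#                   ≈⟨ ⟦⟧-cong (F.*-inverseʳ x x≉0) ⟨
    ι (x F.* F.inv x x≉0)    ≈⟨ *-homo _ _ ⟩
    ι x * ι (F.inv x x≉0)    ≈⟨ *-congʳ ιx≈0 ⟩
    0# * ι (F.inv x x≉0)     ≈⟨ zeroˡ _ ⟩
    0#                       ∎) 1≉0

  ι-*₃ : ∀ x y z → ι (x F.* y F.* z) ≈ ι x * ι y * ι z
  ι-*₃ x y z = trans (*-homo _ _) (*-congʳ (*-homo x y))

  ι-− : ∀ x y → ι (x F.- y) ≈ ι x - ι y
  ι-− x y = trans (+-homo _ _) (+-congˡ (-‿homo y))

  ι-fromℕ : ∀ n → ι (F.fromℕ n) ≈ fromℕ n
  ι-fromℕ zero          = 0#-homo
  ι-fromℕ (suc zero)    = 1#-homo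
  ι-fromℕ (suc (suc n)) = trans (+-homo _ _) (+-cong (ι-fromℕ (suc n)) 1#-homo)

  ι-^′ : ∀ {x y} → ι x ≈ y → ∀ n → ι (x F.^′ n) ≈ y ^′ n
  ι-^′ ιx≈y zero          = 1#-homo
  ι-^′ ιx≈y (suc zero)    = ιx≈y
  ι-^′ ιx≈y (suc (suc n)) = trans (*-homo _ _) (*-cong (ι-^′ ιx≈y (suc n)) ιx≈y)

  ι-⟦⟧ : ∀ {n} (e : Expr ℕ n) (ρ : Vec F.Carrier n) → ι (F.⟦ e ⟧ ρ) ≈ ⟦ e ⟧ (Vec.map ι ρ)
  ι-⟦⟧ (Κ n)   ρ = ι-fromℕ n
  ι-⟦⟧ (Ι i)   ρ = reflexive (≡.sym (Vec.lookup-map i ι ρ))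
  ι-⟦⟧ (x ⊕ y) ρ = trans (+-homo _ _) (+-cong (ι-⟦⟧ x ρ) (ι-⟦⟧ y ρ))
  ι-⟦⟧ (x ⊗ y) ρ = trans (*-homo _ _) (*-cong (ι-⟦⟧ x ρ) (ι-⟦⟧ y ρ))
  ι-⟦⟧ (x ⊛ n) ρ = ι-^′ (ι-⟦⟧ x ρ) n
  ι-⟦⟧ (⊝ x)   ρ = trans (-‿homo _) (-‿cong (ι-⟦⟧ x ρ))

  isolate : ∀ {a x r} (a≉0 : ¬ a F.≈ F.0#) → ι a * x + r ≈ 0# → x ≈ ι (F.- F.inv a a≉0) * r
  isolate {a} {x} {r} a≉0 ax+r≈0 = begin
    x                                ≈⟨ solve 1 (λ x → x := con (+ 1) :* x) refl x ⟩
    1# * x                           ≈⟨ *-congʳ ιa*a⁻¹≈1 ⟨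
    (ι a * a⁻¹) * x                  ≈⟨ solve 4 (λ A A⁻¹ x r → (A :* A⁻¹) :* x := A⁻¹ :* (A :* x :+ r) :- A⁻¹ :* r)
                                                 refl (ι a) a⁻¹ x r ⟩
    a⁻¹ * (ι a * x + r) - a⁻¹ * r    ≈⟨ +-congʳ (*-congˡ ax+r≈0) ⟩
    a⁻¹ * 0# - a⁻¹ * r               ≈⟨ solve 2 (λ A⁻¹ r → A⁻¹ :* con (+ 0) :- A⁻¹ :* r := (:- A⁻¹) :* r)
                                                 refl a⁻¹ r ⟩
    - a⁻¹ * r                        ≈⟨ *-congʳ (-‿homo _) ⟨
    ι (F.- F.inv a a≉0) * r          ∎
    where
    a⁻¹ = ι (F.inv a a≉0)
    ιa*a⁻¹≈1 = trans (sym (*-homo _ _)) (trans (⟦⟧-cong (F.*-inverseʳ a a≉0)) 1#-homo)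

  lincomb-cong : ∀ n {a b} (u : Fin n → Carrier) → (∀ i → a i F.≈ b i) → lincomb n a u ≈ lincomb n b u
  lincomb-cong zero    u a≈b = refl
  lincomb-cong (suc n) u a≈b = +-cong (*-congʳ (⟦⟧-cong (a≈b zero))) (lincomb-cong n (u ∘ suc) (a≈b ∘ suc))

  lincomb-zero : ∀ n {a} (u : Fin n → Carrier) → (∀ i → a i F.≈ F.0#) → lincomb n a u ≈ 0#
  lincomb-zero zero    u a≈0 = refl
  lincomb-zero (suc n) u a≈0 = begin
    ι _ * u zero + lincomb n _ (u ∘ suc)
      ≈⟨ +-cong (*-congʳ (ι≈0 (a≈0 zero))) (lincomb-zero n (u ∘ suc) (a≈0 ∘ suc)) ⟩
    0# * u zero + 0#
      ≈⟨ solve 1 (λ x → con (+ 0) :* x :+ con (+ 0) := con (+ 0)) refl (u zero) ⟩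
    0# ∎

  lincomb-− : ∀ n a b (u : Fin n → Carrier) → lincomb n (λ i → a i F.- b i) u ≈ lincomb n a u - lincomb n b u
  lincomb-− zero    a b u = sym (-‿inverseʳ 0#)
  lincomb-− (suc n) a b u = begin
    ι (a zero F.- b zero) * u zero + lincomb n (λ i → a (suc i) F.- b (suc i)) (u ∘ suc)
      ≈⟨ +-cong (*-congʳ (ι-− _ _)) (lincomb-− n (a ∘ suc) (b ∘ suc) (u ∘ suc)) ⟩
    (ι (a zero) - ι (b zero)) * u zero + (lincomb n (a ∘ suc) (u ∘ suc) - lincomb n (b ∘ suc) (u ∘ suc))
      ≈⟨ solve 5 (λ a b x A B → (a :- b) :* x :+ (A :- B) := (a :* x :+ A) :- (b :* x :+ B)) refl _ _ _ _ _ ⟩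
    (ι (a zero) * u zero + lincomb n (a ∘ suc) (u ∘ suc)) - (ι (b zero) * u zero + lincomb n (b ∘ suc) (u ∘ suc))
      ∎

  span-difference : ∀ {n} {u : Fin n → Carrier} {x y} → InSpan u (x + y) → InSpan u x → InSpan u y
  span-difference {n} {u} {x} {y} (a , x+y≈ua) (b , x≈ub) = (λ i → a i F.- b i) , (begin
    y                                 ≈⟨ solve 2 (λ x y → y := (x :+ y) :- x) refl x y ⟩
    (x + y) - x                       ≈⟨ +-cong x+y≈ua (-‿cong x≈ub) ⟩
    lincomb n a u - lincomb n b u     ≈⟨ lincomb-− n a b u ⟨
    lincomb n (λ i → a i F.- b i) u   ∎)

  squareFree⇒progressionFree : ∀ {n} {v : Fin n → Carrier} → (∀ y → InSpan v y → InSpan v (y * y) → y ≈ 0#) →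
    ¬ (Σ Carrier λ x → Σ Carrier λ y → ¬ y ≈ 0# × InSpan v x × InSpan v (x + y) × InSpan v (x + y * y))
  squareFree⇒progressionFree squareFree (x , y , y≉0 , x∈V , x+y∈V , x+y²∈V) =
    y≉0 (squareFree y (span-difference x+y∈V x∈V) (span-difference x+y²∈V x∈V))

  span-size : ∀ {n} {u : Fin n → Carrier} → LinIndep u → SubsetHasSize K (InSpan u) (q ℕ.^ n)
  span-size {n} {u} independent = record
    { enum      = λ i → lincomb n (F.decode i) u
    ; enum-in   = λ i → F.decode i , refl
    ; enum-inj  = λ i j eq → F.decode-injective λ k →
        F.x-y≈0⇒x≈y _ _ (independent _ (trans (lincomb-− n _ _ u) (x≈y⇒x-y≈0 eq)) k)
    ; enum-surj = λ z (a , z≈ua) → F.encode a , trans (lincomb-cong n u (F.decode-encode a)) (sym z≈ua)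
    }

  module _ {N} (sizeK : HasSize K N) where
    open Finite K sizeK using (enum; enum-inj; index; index-injective)

    nontrivialRelation : ∀ {m} → N ℕ.< q ℕ.^ m → (w : Fin m → Carrier) →
                         Σ (Fin m → F.Carrier) λ a → ¬ (∀ i → a i F.≈ F.0#) × lincomb m a w ≈ 0#
    nontrivialRelation {m} N<q^m w = a , a≉0 , trans (lincomb-− m _ _ w) (x≈y⇒x-y≈0 (index-injective same))
      where
      collision = Fin.pigeonhole N<q^m (λ x → index (lincomb m (F.decode x) w))
      x = proj₁ collision
      y = proj₁ (proj₂ collision)
      x<y = proj₁ (proj₂ (proj₂ collision))
      same = proj₂ (proj₂ (proj₂ collision))

      a : Fin m → F.Carrier
      a k = F.decode x k F.- F.decode y k

      a≉0 : ¬ (∀ k → a k F.≈ F.0#)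
      a≉0 a≈0 = Fin.<⇒≢ x<y (F.decode-injective (λ k → F.x-y≈0⇒x≈y _ _ (a≈0 k)))

    spanning⇒≤ : ∀ {n} {u : Fin n → Carrier} → (∀ z → InSpan u z) → N ℕ.≤ q ℕ.^ n
    spanning⇒≤ {n} {u} spans = Fin.injective⇒≤ coordinates-injective
      where
      coordinates : Fin N → Fin (q ℕ.^ n)
      coordinates i = F.encode (proj₁ (spans (enum i)))

      coordinates-injective : ∀ {i j} → coordinates i ≡ coordinates j → i ≡ j
      coordinates-injective {i} {j} eq = enum-inj i j (begin
        enum i                                 ≈⟨ proj₂ (spans (enum i)) ⟩
        lincomb n (proj₁ (spans (enum i))) u   ≈⟨ lincomb-cong n u (F.encode-injective eq) ⟩
        lincomb n (proj₁ (spans (enum j))) u   ≈⟨ proj₂ (spans (enum j)) ⟨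
        enum j                                 ∎)

module CubicExtension {cF ℓF cK ℓK} (F : CommutativeRing cF ℓF) (K : CommutativeRing cK ℓK)
                      (isFieldF : IsField F) (isFieldK : IsField K) {q} (sizeF : HasSize F q) (odd : Odd q)
                      (ι : CommutativeRing.Carrier F → CommutativeRing.Carrier K)
                      (hom : IsRingHomomorphism (CommutativeRing.rawRing F) (CommutativeRing.rawRing K) ι)
                      (degree3 : LinearAlgebra.HasDegree F K ι 3) where
  open FiniteExtension F K isFieldF isFieldK sizeF ι hom
  open CommutativeRing K hiding (zero)
  open IsRingHomomorphism hom
  open LinearAlgebra F K ι
  open FieldProperties K isFieldK
  open CubicArithmetic K isFieldK
  open import Relation.Binary.Reasoning.Setoid setoid
  open import Algebra.Properties.AbelianGroup +-abelianGroup using ()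
    renaming (x≈y⇒x∙y⁻¹≈ε to x≈y⇒x-y≈0; x∙y⁻¹≈ε⇒x≈y to x-y≈0⇒x≈y)
  open IntegerCoefficientSolver K hiding (⟦_⟧)
  open Eval rawRing fromℕ

  sizeK : HasSize K (q ℕ.^ 3)
  sizeK = record
    { enum = enum ; enum-in = λ _ → tt ; enum-inj = enum-inj
    ; enum-surj = λ z _ → enum-surj z (proj₂ (proj₂ degree3) z) }
    where open SubsetHasSize (span-size {u = proj₁ degree3} (proj₁ (proj₂ degree3)))

  open Finite K sizeK using (_≟_; enum; index; enum-index)

  fewer-than-3-do-not-span : ∀ {n} {u : Fin n → Carrier} → n ℕ.< 3 → ¬ (∀ z → InSpan u z)
  fewer-than-3-do-not-span n<3 spans = ℕ.<⇒≱ (ℕ.^-monoʳ-< q F.1<q n<3) (spanning⇒≤ sizeK spans)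

  four-vectors-dependent : (w : Fin 4 → Carrier) →
                           Σ (Fin 4 → F.Carrier) λ a → ¬ (∀ i → a i F.≈ F.0#) × lincomb 4 a w ≈ 0#
  four-vectors-dependent = nontrivialRelation sizeK (ℕ.^-monoʳ-< q F.1<q (ℕ.n<1+n 3))

  IsScalar : Carrier → Set (cF ⊔ ℓK)
  IsScalar y = Σ F.Carrier λ a → y ≈ ι a

  isScalar? : ∀ y → Dec (IsScalar y)
  isScalar? y with Fin.any? (λ i → y ≟ ι (F.enum i))
  ... | yes (i , y≈ιi) = yes (F.enum i , y≈ιi)
  ... | no  ¬scalar   = no λ (a , y≈ιa) → ¬scalar (F.index a , trans y≈ιa (⟦⟧-cong (F.sym (F.enum-index a))))

  ∃nonScalar : ∃ λ y → ¬ IsScalar y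
  ∃nonScalar with Fin.any? (λ i → ¬? (isScalar? (enum i)))
  ... | yes (i , nonScalar) = enum i , nonScalar
  ... | no  allScalar       =
    contradiction scalars-span (fewer-than-3-do-not-span {u = lookup (1# ∷ [])} (ℕ.s≤s (ℕ.s≤s ℕ.z≤n)))
    where
    scalar : ∀ z → IsScalar z
    scalar z = decidable-stable (isScalar? z) λ z∉F →
      allScalar (index z , λ (a , e≈ιa) → z∉F (a , trans (sym (enum-index z)) e≈ιa))

    scalars-span : ∀ z → InSpan (lookup (1# ∷ [])) z
    scalars-span z = (λ _ → proj₁ (scalar z)) ,
      trans (proj₂ (scalar z)) (solve 1 (λ x → x := x :* con (+ 1) :+ con (+ 0)) refl (ι (proj₁ (scalar z))))

  nonScalar⇒independent₂ : ∀ {y} → ¬ IsScalar y → ∀ {a b} → ι a + ι b * y ≈ 0# → a F.≈ F.0# × b F.≈ F.0#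
  nonScalar⇒independent₂ {y} y∉F {a} {b} a+by≈0 with b F.≟ F.0#
  ... | no  b≉0 = contradiction (_ , trans (isolate b≉0 (trans (+-comm _ _) a+by≈0)) (sym (*-homo _ _))) y∉F
  ... | yes b≈0 = ι-injective (begin
    ι a              ≈⟨ solve 2 (λ A y → A := A :+ con (+ 0) :* y) refl (ι a) y ⟩
    ι a + 0# * y     ≈⟨ +-congˡ (*-congʳ (ι≈0 b≈0)) ⟨
    ι a + ι b * y    ≈⟨ a+by≈0 ⟩
    0#               ∎) , b≈0

  module Quadratic {y p r} (y∉F : ¬ IsScalar y) (y²≈p+ry : y * y ≈ ι p + ι r * y) where

    ȳ : Carrier
    ȳ = ι r - y

    ȳ∉F : ¬ IsScalar ȳ
    ȳ∉F (s , ȳ≈s) = y∉F (r F.- s , (begin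
      y              ≈⟨ solve 2 (λ r y → y := r :- (r :- y)) refl (ι r) y ⟩
      ι r - ȳ        ≈⟨ +-congˡ (-‿cong ȳ≈s) ⟩
      ι r - ι s      ≈⟨ ι-− r s ⟨
      ι (r F.- s)    ∎))

    conjugate-product : ∀ u v a b → (ι u + ι v * ȳ) * (ι a + ι b * y) ≈
                        ι (a F.* u F.+ a F.* v F.* r F.- b F.* v F.* p) + ι (b F.* u F.- a F.* v) * y
    conjugate-product u v a b = begin
      (ι u + ι v * ȳ) * (ι a + ι b * y)
        ≈⟨ solve 6 (λ u v a b r y → (u :+ v :* (r :- y)) :* (a :+ b :* y)
                                    := a :* u :+ a :* v :* r :+ (b :* u :+ b :* v :* r :- a :* v) :* y :- b :* v :* (y :* y))
                 refl (ι u) (ι v) (ι a) (ι b) (ι r) y ⟩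
      ι a * ι u + ι a * ι v * ι r + (ι b * ι u + ι b * ι v * ι r - ι a * ι v) * y - ι b * ι v * (y * y)
        ≈⟨ +-congˡ (-‿cong (*-congˡ y²≈p+ry)) ⟩
      ι a * ι u + ι a * ι v * ι r + (ι b * ι u + ι b * ι v * ι r - ι a * ι v) * y - ι b * ι v * (ι p + ι r * y)
        ≈⟨ solve 7 (λ u v a b p r y →
                      a :* u :+ a :* v :* r :+ (b :* u :+ b :* v :* r :- a :* v) :* y :- b :* v :* (p :+ r :* y)
                      := (a :* u :+ a :* v :* r :- b :* v :* p) :+ (b :* u :- a :* v) :* y)
                 refl (ι u) (ι v) (ι a) (ι b) (ι p) (ι r) y ⟩
      (ι a * ι u + ι a * ι v * ι r - ι b * ι v * ι p) + (ι b * ι u - ι a * ι v) * y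
        ≈⟨ +-cong (trans (ι-− _ _) (+-cong (trans (+-homo _ _) (+-cong (*-homo _ _) (ι-*₃ _ _ _))) (-‿cong (ι-*₃ _ _ _))))
                  (*-congʳ (trans (ι-− _ _) (+-cong (*-homo _ _) (-‿cong (*-homo _ _))))) ⟨
      ι (a F.* u F.+ a F.* v F.* r F.- b F.* v F.* p) + ι (b F.* u F.- a F.* v) * y
        ∎

    norm : F.Carrier → F.Carrier → F.Carrier
    norm u v = u F.* u F.+ u F.* v F.* r F.- v F.* v F.* p

    norm-product : ∀ u v → (ι u + ι v * ȳ) * (ι u + ι v * y) ≈ ι (norm u v)
    norm-product u v = begin
      (ι u + ι v * ȳ) * (ι u + ι v * y)              ≈⟨ conjugate-product u v u v ⟩
      ι (norm u v) + ι (v F.* u F.- u F.* v) * y     ≈⟨ +-congˡ (*-congʳ (ι≈0 vu-uv≈0)) ⟩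
      ι (norm u v) + 0# * y                          ≈⟨ solve 2 (λ N y → N :+ con (+ 0) :* y := N) refl (ι (norm u v)) y ⟩
      ι (norm u v)                                   ∎
      where vu-uv≈0 = F.trans (F.+-congʳ (F.*-comm v u)) (F.-‿inverseʳ (u F.* v))

    norm≈0⇒≈0 : ∀ {u v} → norm u v F.≈ F.0# → u F.≈ F.0# × v F.≈ F.0#
    norm≈0⇒≈0 {u} {v} N≈0 = [ nonScalar⇒independent₂ ȳ∉F , nonScalar⇒independent₂ y∉F ]′
                               (x*y≈0⇒x≈0∨y≈0 _≟_ (trans (norm-product u v) (ι≈0 N≈0)))

    relation⇒span : ∀ {a₀ a₁ a₂ a₃ z} → ¬ norm a₂ a₃ F.≈ F.0# →
                    ι a₀ + ι a₁ * y + (ι a₂ + ι a₃ * y) * z ≈ 0# → InSpan (lookup (1# ∷ y ∷ [])) z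
    relation⇒span {a₀} {a₁} {a₂} {a₃} {z} N≉0 relation = lookup (m F.* M₀ ∷ m F.* M₁ ∷ []) , (begin
      z                                           ≈⟨ isolate N≉0 Nz+M≈0 ⟩
      ι m * (ι M₀ + ι M₁ * y)                     ≈⟨ solve 4 (λ m M₀ M₁ y → m :* (M₀ :+ M₁ :* y)
                                                                 := m :* M₀ :* con (+ 1) :+ (m :* M₁ :* y :+ con (+ 0)))
                                                           refl (ι m) (ι M₀) (ι M₁) y ⟩
      ι m * ι M₀ * 1# + (ι m * ι M₁ * y + 0#)     ≈⟨ +-cong (*-congʳ (*-homo _ _)) (+-congʳ (*-congʳ (*-homo _ _))) ⟨
      ι (m F.* M₀) * 1# + (ι (m F.* M₁) * y + 0#) ∎)
      where
      m = F.- F.inv (norm a₂ a₃) N≉0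
      M₀ = a₀ F.* a₂ F.+ a₀ F.* a₃ F.* r F.- a₁ F.* a₃ F.* p
      M₁ = a₁ F.* a₂ F.- a₀ F.* a₃
      β̄ = ι a₂ + ι a₃ * ȳ

      Nz+M≈0 : ι (norm a₂ a₃) * z + (ι M₀ + ι M₁ * y) ≈ 0#
      Nz+M≈0 = begin
        ι (norm a₂ a₃) * z + (ι M₀ + ι M₁ * y)
          ≈⟨ +-cong (*-congʳ (norm-product a₂ a₃)) (conjugate-product a₂ a₃ a₀ a₁) ⟨
        β̄ * (ι a₂ + ι a₃ * y) * z + β̄ * (ι a₀ + ι a₁ * y)
          ≈⟨ solve 4 (λ β̄ β z α → β̄ :* β :* z :+ β̄ :* α := β̄ :* (α :+ β :* z))
                     refl β̄ (ι a₂ + ι a₃ * y) z (ι a₀ + ι a₁ * y) ⟩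
        β̄ * (ι a₀ + ι a₁ * y + (ι a₂ + ι a₃ * y) * z)
          ≈⟨ *-congˡ relation ⟩
        β̄ * 0#
          ≈⟨ zeroʳ β̄ ⟩
        0# ∎

    dependent⇒norm≉0 : ∀ {z a} → ¬ (∀ i → a i F.≈ F.0#) →
                       lincomb 4 a (lookup (1# ∷ y ∷ z ∷ y * z ∷ [])) ≈ 0# → ¬ norm (a (# 2)) (a (# 3)) F.≈ F.0#
    dependent⇒norm≉0 {z} {a} a≉0 a·w≈0 N≈0 = a≉0 λ
      { zero                   → proj₁ a₀≈0×a₁≈0
      ; (suc zero)             → proj₂ a₀≈0×a₁≈0
      ; (suc (suc zero))       → proj₁ a₂≈0×a₃≈0
      ; (suc (suc (suc zero))) → proj₂ a₂≈0×a₃≈0 }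
      where
      a₂≈0×a₃≈0 = norm≈0⇒≈0 N≈0
      a₀≈0×a₁≈0 = nonScalar⇒independent₂ y∉F (begin
        ι (a (# 0)) + ι (a (# 1)) * y
          ≈⟨ solve 4 (λ a₀ a₁ y z → a₀ :+ a₁ :* y
                       := a₀ :* con (+ 1) :+ (a₁ :* y :+ (con (+ 0) :* z :+ (con (+ 0) :* (y :* z) :+ con (+ 0)))))
                     refl (ι (a (# 0))) (ι (a (# 1))) y z ⟩
        ι (a (# 0)) * 1# + (ι (a (# 1)) * y + (0# * z + (0# * (y * z) + 0#)))
          ≈⟨ +-congˡ (+-congˡ (+-cong (*-congʳ (ι≈0 (proj₁ a₂≈0×a₃≈0)))
                                      (+-congʳ (*-congʳ (ι≈0 (proj₂ a₂≈0×a₃≈0)))))) ⟨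
        lincomb 4 a (lookup (1# ∷ y ∷ z ∷ y * z ∷ []))
          ≈⟨ a·w≈0 ⟩
        0# ∎)

    spanning : ∀ z → InSpan (lookup (1# ∷ y ∷ [])) z
    spanning z =
      let a , a≉0 , a·w≈0 = four-vectors-dependent (lookup (1# ∷ y ∷ z ∷ y * z ∷ []))
      in relation⇒span (dependent⇒norm≉0 a≉0 a·w≈0) (trans
           (solve 6 (λ a₀ a₁ a₂ a₃ y z → a₀ :+ a₁ :* y :+ (a₂ :+ a₃ :* y) :* z
                       := a₀ :* con (+ 1) :+ (a₁ :* y :+ (a₂ :* z :+ (a₃ :* (y :* z) :+ con (+ 0)))))
                    refl (ι (a (# 0))) (ι (a (# 1))) (ι (a (# 2))) (ι (a (# 3))) y z)
           a·w≈0)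

  IndependentPowers : Carrier → Set (cF ⊔ ℓF ⊔ ℓK)
  IndependentPowers y = ∀ a₀ a₁ a₂ → ι a₀ + ι a₁ * y + ι a₂ * (y * y) ≈ 0# →
                        a₀ F.≈ F.0# × a₁ F.≈ F.0# × a₂ F.≈ F.0#

  nonScalar⇒independentPowers : ∀ {y} → ¬ IsScalar y → IndependentPowers y
  nonScalar⇒independentPowers {y} y∉F a₀ a₁ a₂ a₀+a₁y+a₂y²≈0 with a₂ F.≟ F.0#
  ... | yes a₂≈0 = let a₀≈0 , a₁≈0 = nonScalar⇒independent₂ y∉F a₀+a₁y≈0 in a₀≈0 , a₁≈0 , a₂≈0
    where
    a₀+a₁y≈0 : ι a₀ + ι a₁ * y ≈ 0#
    a₀+a₁y≈0 = begin
      ι a₀ + ι a₁ * y                   ≈⟨ solve 3 (λ a₀ a₁ y → a₀ :+ a₁ :* y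
                                                              := a₀ :+ a₁ :* y :+ con (+ 0) :* (y :* y))
                                                    refl (ι a₀) (ι a₁) y ⟩
      ι a₀ + ι a₁ * y + 0# * (y * y)    ≈⟨ +-congˡ (*-congʳ (ι≈0 a₂≈0)) ⟨
      ι a₀ + ι a₁ * y + ι a₂ * (y * y)  ≈⟨ a₀+a₁y+a₂y²≈0 ⟩
      0#                                ∎
  ... | no a₂≉0 = contradiction (Quadratic.spanning y∉F y²≈p+ry)
                                (fewer-than-3-do-not-span {u = lookup (1# ∷ y ∷ [])} (ℕ.n<1+n 2))
    where
    m = F.- F.inv a₂ a₂≉0

    y²≈p+ry : y * y ≈ ι (m F.* a₀) + ι (m F.* a₁) * y
    y²≈p+ry = begin
      y * y
        ≈⟨ isolate a₂≉0 (trans (solve 4 (λ a₀ a₁ a₂ y → a₂ :* (y :* y) :+ (a₀ :+ a₁ :* y)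
                                                      := a₀ :+ a₁ :* y :+ a₂ :* (y :* y))
                                        refl (ι a₀) (ι a₁) (ι a₂) y)
                                 a₀+a₁y+a₂y²≈0) ⟩
      ι m * (ι a₀ + ι a₁ * y)
        ≈⟨ solve 4 (λ m a₀ a₁ y → m :* (a₀ :+ a₁ :* y) := m :* a₀ :+ m :* a₁ :* y) refl (ι m) (ι a₀) (ι a₁) y ⟩
      ι m * ι a₀ + ι m * ι a₁ * y
        ≈⟨ +-cong (*-homo _ _) (*-congʳ (*-homo _ _)) ⟨
      ι (m F.* a₀) + ι (m F.* a₁) * y ∎

  RootOfCubic : F.Carrier → F.Carrier → F.Carrier → Carrier → Set ℓK
  RootOfCubic a b c y = y * (y * y) ≈ ι a * (y * y) + ι b * y + ι c

  independentPowers⇒root : ∀ {y} → IndependentPowers y →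
                           Σ F.Carrier λ a → Σ F.Carrier λ b → Σ F.Carrier λ c → RootOfCubic a b c y
  independentPowers⇒root {y} independent = m F.* a₂ , m F.* a₁ , m F.* a₀ , (begin
    y * (y * y)
      ≈⟨ isolate a₃≉0 (trans (solve 5 (λ a₀ a₁ a₂ a₃ y →
           a₃ :* (y :* (y :* y)) :+ (a₂ :* (y :* y) :+ a₁ :* y :+ a₀)
           := a₀ :* con (+ 1) :+ (a₁ :* y :+ (a₂ :* (y :* y) :+ (a₃ :* (y :* (y :* y)) :+ con (+ 0)))))
           refl (ι a₀) (ι a₁) (ι a₂) (ι a₃) y) a·w≈0) ⟩
    ι m * (ι a₂ * (y * y) + ι a₁ * y + ι a₀)
      ≈⟨ solve 5 (λ m a₀ a₁ a₂ y → m :* (a₂ :* (y :* y) :+ a₁ :* y :+ a₀)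
                                  := m :* a₂ :* (y :* y) :+ m :* a₁ :* y :+ m :* a₀)
                 refl (ι m) (ι a₀) (ι a₁) (ι a₂) y ⟩
    ι m * ι a₂ * (y * y) + ι m * ι a₁ * y + ι m * ι a₀
      ≈⟨ +-cong (+-cong (*-congʳ (*-homo _ _)) (*-congʳ (*-homo _ _))) (*-homo _ _) ⟨
    ι (m F.* a₂) * (y * y) + ι (m F.* a₁) * y + ι (m F.* a₀) ∎)
    where
    w = lookup (1# ∷ y ∷ y * y ∷ y * (y * y) ∷ [])
    dependence = four-vectors-dependent w
    a = proj₁ dependence
    a·w≈0 = proj₂ (proj₂ dependence)
    a₀ = a (# 0)
    a₁ = a (# 1)
    a₂ = a (# 2)
    a₃ = a (# 3)

    a₃≉0 : ¬ a₃ F.≈ F.0#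
    a₃≉0 a₃≈0 = proj₁ (proj₂ dependence) λ
      { zero                   → proj₁ lower≈0
      ; (suc zero)             → proj₁ (proj₂ lower≈0)
      ; (suc (suc zero))       → proj₂ (proj₂ lower≈0)
      ; (suc (suc (suc zero))) → a₃≈0 }
      where
      lower≈0 = independent a₀ a₁ a₂ (begin
        ι a₀ + ι a₁ * y + ι a₂ * (y * y)
          ≈⟨ solve 4 (λ a₀ a₁ a₂ y → a₀ :+ a₁ :* y :+ a₂ :* (y :* y)
               := a₀ :* con (+ 1) :+ (a₁ :* y :+ (a₂ :* (y :* y) :+ (con (+ 0) :* (y :* (y :* y)) :+ con (+ 0)))))
               refl (ι a₀) (ι a₁) (ι a₂) y ⟩
        ι a₀ * 1# + (ι a₁ * y + (ι a₂ * (y * y) + (0# * (y * (y * y)) + 0#)))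
          ≈⟨ +-congˡ (+-congˡ (+-congˡ (+-congʳ (*-congʳ (ι≈0 a₃≈0))))) ⟨
        lincomb 4 a w
          ≈⟨ a·w≈0 ⟩
        0# ∎)

    m = F.- F.inv a₃ a₃≉0

  root-constant≉0 : ∀ {a b c y} → IndependentPowers y → RootOfCubic a b c y → ¬ c F.≈ F.0#
  root-constant≉0 {a} {b} {c} {y} independent root c≈0 =
    IsField.1≉0 isFieldF (proj₂ (proj₂ (independent (F.- b) (F.- a) F.1# y²-ay-b≈0)))
    where
    y≉0 : ¬ y ≈ 0#
    y≉0 y≈0 = IsField.1≉0 isFieldF (proj₁ (proj₂ (independent F.0# F.1# F.0# (begin
      ι F.0# + ι F.1# * y + ι F.0# * (y * y)  ≈⟨ +-cong (+-cong 0#-homo (*-cong 1#-homo y≈0)) (*-congʳ 0#-homo) ⟩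
      0# + 1# * 0# + 0# * (y * y)             ≈⟨ solve 1 (λ x → con (+ 0) :+ con (+ 1) :* con (+ 0) :+ con (+ 0) :* x := con (+ 0))
                                                          refl (y * y) ⟩
      0#                                      ∎))))

    y²-ay-b≈0 : ι (F.- b) + ι (F.- a) * y + ι F.1# * (y * y) ≈ 0#
    y²-ay-b≈0 = begin
      ι (F.- b) + ι (F.- a) * y + ι F.1# * (y * y)
        ≈⟨ +-cong (+-cong (-‿homo b) (*-congʳ (-‿homo a))) (*-congʳ 1#-homo) ⟩
      - ι b + - ι a * y + 1# * (y * y)
        ≈⟨ *-cancelˡ-≈0 y≉0 (begin
             y * (- ι b + - ι a * y + 1# * (y * y))
               ≈⟨ solve 4 (λ a b c y → y :* (:- b :+ :- a :* y :+ con (+ 1) :* (y :* y))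
                                       := (y :* (y :* y) :- (a :* (y :* y) :+ b :* y :+ c)) :+ c)
                          refl (ι a) (ι b) (ι c) y ⟩
             (y * (y * y) - (ι a * (y * y) + ι b * y + ι c)) + ι c
               ≈⟨ +-cong (x≈y⇒x-y≈0 root) (ι≈0 c≈0) ⟩
             0# + 0#
               ≈⟨ +-identityʳ 0# ⟩
             0# ∎) ⟩
      0# ∎

  rescaled-nonScalar : ∀ {w k} → ¬ IsScalar w → ¬ k F.≈ F.0# → ¬ IsScalar (1# - ι k * w)
  rescaled-nonScalar {w} {k} w∉F k≉0 (s , 1-kw≈s) = w∉F (_ , (begin
    w                                 ≈⟨ isolate k≉0 (begin
      ι k * w + (ι s - 1#)            ≈⟨ +-congˡ (+-congʳ 1-kw≈s) ⟨
      ι k * w + ((1# - ι k * w) - 1#) ≈⟨ solve 2 (λ k w → k :* w :+ ((con (+ 1) :- k :* w) :- con (+ 1)) := con (+ 0))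
                                                  refl (ι k) w ⟩
      0#                              ∎) ⟩
    ι m * (ι s - 1#)                  ≈⟨ *-congˡ (trans (ι-− s F.1#) (+-congˡ (-‿cong 1#-homo))) ⟨
    ι m * ι (s F.- F.1#)              ≈⟨ *-homo _ _ ⟨
    ι (m F.* (s F.- F.1#))            ∎))
    where m = F.- F.inv k k≉0

  rescaled-root : ∀ {w A B C} k → RootOfCubic A B C w →
                  Σ F.Carrier λ a → Σ F.Carrier λ b → Σ F.Carrier λ c →
                    RootOfCubic a b c (1# - ι k * w) × F.1# F.- a F.- b F.- c F.≈ k F.* k F.* k F.* C
  rescaled-root {w} {A} {B} {C} k root =
    F.⟦ rescaled-a ⟧ κ , F.⟦ rescaled-b ⟧ κ , F.⟦ rescaled-c ⟧ κ , θ-root , F.rescaled-discriminant k A B C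
    where
    κ = k ∷ A ∷ B ∷ C ∷ []
    θ = 1# - ι k * w

    θ-root : RootOfCubic (F.⟦ rescaled-a ⟧ κ) (F.⟦ rescaled-b ⟧ κ) (F.⟦ rescaled-c ⟧ κ) θ
    θ-root = begin
      θ * (θ * θ)
        ≈⟨ x-y≈0⇒x≈y _ _ (trans (rescaled-cubic (ι k) (ι A) (ι B) (ι C) w)
                                (trans (*-congˡ (x≈y⇒x-y≈0 root)) (zeroʳ _))) ⟩
      ⟦ rescaled-a ⟧ (Vec.map ι κ) * (θ * θ) + ⟦ rescaled-b ⟧ (Vec.map ι κ) * θ + ⟦ rescaled-c ⟧ (Vec.map ι κ)
        ≈⟨ +-cong (+-cong (*-congʳ (ι-⟦⟧ rescaled-a κ)) (*-congʳ (ι-⟦⟧ rescaled-b κ))) (ι-⟦⟧ rescaled-c κ) ⟨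
      ι (F.⟦ rescaled-a ⟧ κ) * (θ * θ) + ι (F.⟦ rescaled-b ⟧ κ) * θ + ι (F.⟦ rescaled-c ⟧ κ)
        ∎

  plane : Carrier → F.Carrier → Fin 2 → Carrier
  plane θ c = lookup (θ ∷ ι c + θ * θ ∷ [])

  plane-independent : ∀ {θ} c → IndependentPowers θ → LinIndep (plane θ c)
  plane-independent {θ} c independent st st·v≈0 = λ { zero → proj₁ (proj₂ st≈0) ; (suc zero) → proj₂ (proj₂ st≈0) }
    where
    s = st zero
    t = st (suc zero)
    st≈0 = independent (t F.* c) s t (begin
      ι (t F.* c) + ι s * θ + ι t * (θ * θ)  ≈⟨ +-congʳ (+-congʳ (*-homo t c)) ⟩
      ι t * ι c + ι s * θ + ι t * (θ * θ)    ≈⟨ solve 4 (λ s t c θ → t :* c :+ s :* θ :+ t :* (θ :* θ)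
                                                              := s :* θ :+ (t :* (c :+ θ :* θ) :+ con (+ 0)))
                                                              refl (ι s) (ι t) (ι c) θ ⟩
      lincomb 2 st (plane θ c)               ≈⟨ st·v≈0 ⟩
      0#                                     ∎)

  plane-squareFree : ∀ {θ a b c} → IndependentPowers θ → RootOfCubic a b c θ →
                     F.NonSquare (F.1# F.- a F.- b F.- c) →
                     ∀ y → InSpan (plane θ c) y → InSpan (plane θ c) (y * y) → y ≈ 0#
  plane-squareFree {θ} {a} {b} {c} independent root d-nonSquare y (st , y≈st·v) (st′ , y²≈st′·v) =
    trans y≈st·v (lincomb-zero 2 {st} (plane θ c) λ { zero → proj₁ s≈0×t≈0 ; (suc zero) → proj₂ s≈0×t≈0 })
    where
    s = st zero
    t = st (suc zero)
    s′ = st′ zero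
    t′ = st′ (suc zero)
    κ = s ∷ t ∷ s′ ∷ t′ ∷ a ∷ b ∷ c ∷ []

    Y Y′ : Carrier
    Y  = ι s * θ + ι t * (ι c + θ * θ)
    Y′ = ι s′ * θ + ι t′ * (ι c + θ * θ)

    Y²≈Y′ : Y * Y ≈ Y′
    Y²≈Y′ = trans (*-cong (sym y≈Y) (sym y≈Y)) (trans y²≈st′·v (+-congˡ (+-identityʳ _)))
      where y≈Y = trans y≈st·v (+-congˡ (+-identityʳ _))

    P : Carrier
    P = ι t * ι t * θ + (fromℕ 2 * ι s * ι t + ι t * ι t * ι a)

    coordinates≈0 = independent _ _ _ (begin
      ι (F.⟦ square-coordinate₀ ⟧ κ) + ι (F.⟦ square-coordinate₁ ⟧ κ) * θ
        + ι (F.⟦ square-coordinate₂ ⟧ κ) * (θ * θ)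
          ≈⟨ +-cong (+-cong (ι-⟦⟧ square-coordinate₀ κ) (*-congʳ (ι-⟦⟧ square-coordinate₁ κ)))
                    (*-congʳ (ι-⟦⟧ square-coordinate₂ κ)) ⟩
      ⟦ square-coordinate₀ ⟧ (Vec.map ι κ) + ⟦ square-coordinate₁ ⟧ (Vec.map ι κ) * θ
        + ⟦ square-coordinate₂ ⟧ (Vec.map ι κ) * (θ * θ)
          ≈⟨ square-expansion (ι s) (ι t) (ι s′) (ι t′) (ι a) (ι b) (ι c) θ ⟩
      (Y * Y - Y′) - P * (θ * (θ * θ) - (ι a * (θ * θ) + ι b * θ + ι c))
          ≈⟨ +-cong (x≈y⇒x-y≈0 Y²≈Y′) (-‿cong (*-congˡ (x≈y⇒x-y≈0 root))) ⟩
      0# - P * 0#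
          ≈⟨ solve 1 (λ P → con (+ 0) :- P :* con (+ 0) := con (+ 0)) refl P ⟩
      0# ∎)

    s≈0×t≈0 = F.square-coordinates≈0 F._≟_ {s′ = s′} (root-constant≉0 independent root) d-nonSquare
                (proj₁ coordinates≈0) (proj₂ (proj₂ coordinates≈0))

  squareFree-plane : Σ (Fin 2 → Carrier) λ v → LinIndep v × (∀ y → InSpan v y → InSpan v (y * y) → y ≈ 0#)
  squareFree-plane =
    let w , w∉F = ∃nonScalar
        w-independent = nonScalar⇒independentPowers w∉F
        _ , _ , C , w-root = independentPowers⇒root w-independent
        C≉0 = root-constant≉0 w-independent w-root
        n , n-nonSquare = F.∃nonSquare odd
        -- k = C n makes 1 − a − b − c = k³ C = (C² n)² n a non-square
        θ-independent = nonScalar⇒independentPowers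
                          (rescaled-nonScalar w∉F (F.*-nonzero C≉0 (F.nonSquare⇒≉0 n-nonSquare)))
        _ , _ , c , θ-root , d≈k³C = rescaled-root (C F.* n) w-root
    in plane _ c , plane-independent c θ-independent
     , plane-squareFree θ-independent θ-root (F.nonSquare-resp (F.sym d≈k³C) (F.nonSquare-cube n-nonSquare C≉0))

theorem5p1 : ∀ {c ℓ c' ℓ'} (F : CommutativeRing c ℓ) (K : CommutativeRing c' ℓ') →
  IsField F → IsField K →
  (q : ℕ) → HasSize F q → Odd q →
  (ι : CommutativeRing.Carrier F → CommutativeRing.Carrier K) →
  IsRingHomomorphism (CommutativeRing.rawRing F) (CommutativeRing.rawRing K) ι →
  LinearAlgebra.HasDegree F K ι 3 →
  let open CommutativeRing K
      open LinearAlgebra F K ι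
  in Σ (Fin 2 → Carrier) (λ v →
       LinIndep v
       × (∀ y → InSpan v y → InSpan v (y * y) → y ≈ 0#)
       × SubsetHasSize K (InSpan v) (q ℕ.* q)
       × HasSize K (q ℕ.* q ℕ.* q)
       × ¬ (Σ Carrier (λ x → Σ Carrier (λ y →
             ¬ (y ≈ 0#) × InSpan v x × InSpan v (x + y) × InSpan v (x + y * y)))))
theorem5p1 F K isFieldF isFieldK q sizeF odd ι hom degree3 =
  v , v-independent , v-squareFree
  , ≡.subst (SubsetHasSize K (InSpan v)) q^2≡q*q (span-size {u = v} v-independent)
  , ≡.subst (HasSize K) q^3≡q*q*q sizeK
  , squareFree⇒progressionFree {v = v} v-squareFree
  where
  open LinearAlgebra F K ι
  open FiniteExtension F K isFieldF isFieldK sizeF ι hom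
  open CubicExtension F K isFieldF isFieldK sizeF odd ι hom degree3

  v = proj₁ squareFree-plane
  v-independent = proj₁ (proj₂ squareFree-plane)
  v-squareFree = proj₂ (proj₂ squareFree-plane)

  q^2≡q*q : q ℕ.^ 2 ≡ q ℕ.* q
  q^2≡q*q = ≡.cong (q ℕ.*_) (ℕ.*-identityʳ q)

  q^3≡q*q*q : q ℕ.^ 3 ≡ q ℕ.* q ℕ.* q
  q^3≡q*q*q = ≡.trans (≡.cong (q ℕ.*_) q^2≡q*q) (≡.sym (ℕ.*-assoc q q q))
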